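{- Let $k\ge2$ and let $*$ be a binary operation on a set such that for every $n$ and all full linear terms $s,t$ over $X_n$, $s^{*}=t^{*}$ if and only if $\rho_{T_s}(x_i)\equiv\rho_{T_t}(x_i)\pmod k$ for all $i=1,\dots,n$. Then for all $n\ge1$, \[ s^{\mathrm{ac}}_n(*)=k!\,S(n,k)+n\sum_{0\le i\le k-2} i!\,S(n-1,i), \] and \[ \sum_{n\ge1}\frac{s^{\mathrm{ac}}_n(*)}{n!}t^n=(e^t-1)^k+\sum_{0\le i\le k-2} t(e^t-1)^i. \]
   Context: For $X_n=\{x_1,\dots,x_n\}$, groupoid terms are built recursively from variables by $(s,t)\mapsto(st)$; a full linear term over $X_n$ is a term in which each variable occurs exactly once, and $t^{*}$ denotes the induced $n$-ary term operation. Each term $t$ corresponds to an ordered binary tree $T_t$ with leaves labeled by variables: a variable is a one-vertex tree, and $(t_1t_2)$ has left subtree $T_{t_1}$ and right subtree $T_{t_2}$. $\rho_T(x_i)$ is the right depth of the leaf labeled $x_i$, i.e., the number of right steps on the path from the root to it. $s^{\mathrm{ac}}_n(*)$ is the number of distinct term operations induced by full linear terms over $X_n$. $S(n,k)$ is the Stirling number of the second kind (number of partitions of an $n$-set into $k$ nonempty blocks), with $S(0,0)=1$ and $S(m,0)=0$ for $m>0$. -}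

module Defs where

open import Data.Nat using (ℕ; zero; suc; _+_; _*_; _∸_; _≤_; _!; ∣_-_∣)
open import Data.Nat.Properties using (_!≢0)
open import Data.Nat.Divisibility using (_∣_)
open import Data.Fin using (Fin)
open import Data.Fin.Properties using (_≟_)
open import Data.List using (List; []; _∷_; length; map; upTo; foldr)
open import Data.List.Membership.Propositional using (_∈_)
open import Data.Product using (Σ; ∃; _×_; _,_)
open import Data.Integer using (+_)
open import Data.Rational as ℚ using (ℚ; 0ℚ; 1ℚ)
open import Relation.Nullary using (¬_; yes; no)
open import Relation.Binary.PropositionalEquality using (_≡_)

-- Groupoid terms over X_n = {x_0, …, x_{n-1}} (variables indexed by Fin n)

data Term (n : ℕ) : Set where
  var  : Fin n → Term n
  _·_  : Term n → Term n → Term n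

occ : ∀ {n} → Term n → Fin n → ℕ
occ (var j) i with j ≟ i
... | yes _ = 1
... | no  _ = 0
occ (s · t) i = occ s i + occ t i

FullLinear : ∀ {n} → Term n → Set
FullLinear {n} t = ∀ (i : Fin n) → occ t i ≡ 1

eval : ∀ {n} {A : Set} → (A → A → A) → Term n → (Fin n → A) → A
eval _∙_ (var i) v = v i
eval _∙_ (s · t) v = eval _∙_ s v ∙ eval _∙_ t v

SameOp : ∀ {n} {A : Set} → (A → A → A) → Term n → Term n → Set
SameOp {n} {A} _∙_ s t = ∀ (v : Fin n → A) → eval _∙_ s v ≡ eval _∙_ t v

-- right depth ρ_{T_t}(x_i): number of right steps from the root to the
-- leaf labelled x_i.  (Meaningful when x_i occurs exactly once in t,
-- which is the case for full linear terms.)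
rdepth : ∀ {n} → Term n → Fin n → ℕ
rdepth (var j) i = 0
rdepth (s · t) i with occ s i
... | zero  = suc (rdepth t i)
... | suc _ = rdepth s i

_≡_[mod_] : ℕ → ℕ → ℕ → Set
a ≡ b [mod k ] = k ∣ ∣ a - b ∣

-- s^ac_n(*) = N : the number of distinct term operations induced by full
-- linear terms over X_n is N, i.e. there is a list of N full linear terms
-- inducing pairwise distinct term operations such that every full linear
-- term induces the same operation as one of them.

Pairwise : ∀ {X : Set} → (X → X → Set) → List X → Set
Pairwise R []       = Data.Unit.⊤ where import Data.Unit
Pairwise R (x ∷ xs) = ((y : _) → y ∈ xs → R x y) × Pairwise R xs

SacIs : {A : Set} → (A → A → A) → ℕ → ℕ → Set
SacIs {A} _∙_ n N =
  Σ (List (Term n)) λ L →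
      (length L ≡ N)
    × ((t : Term n) → t ∈ L → FullLinear t)
    × Pairwise (λ s t → ¬ SameOp _∙_ s t) L
    × ((t : Term n) → FullLinear t → ∃ λ s → s ∈ L × SameOp _∙_ t s)

S : ℕ → ℕ → ℕ
S zero    zero    = 1
S zero    (suc k) = 0
S (suc n) zero    = 0
S (suc n) (suc k) = suc k * S n (suc k) + S n k

sumTo : ℕ → (ℕ → ℕ) → ℕ
sumTo m f = foldr (λ i acc → f i + acc) 0 (upTo m)

PS : Set
PS = ℕ → ℚ

sumℚ : List ℚ → ℚ
sumℚ = foldr ℚ._+_ 0ℚ

_⊕_ : PS → PS → PS
(f ⊕ g) n = f n ℚ.+ g n

_⊛_ : PS → PS → PS
(f ⊛ g) n = sumℚ (map (λ i → f i ℚ.* g (n ∸ i)) (upTo (suc n)))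

onePS : PS
onePS zero    = 1ℚ
onePS (suc _) = 0ℚ

zeroPS : PS
zeroPS _ = 0ℚ

_^PS_ : PS → ℕ → PS
f ^PS zero    = onePS
f ^PS (suc m) = f ⊛ (f ^PS m)

tPS : PS
tPS 1 = 1ℚ
tPS _ = 0ℚ

inv! : ℕ → ℚ
inv! n = ℚ._/_ (+ 1) (n !) {{n !≢0}}

expm1 : PS
expm1 zero    = 0ℚ
expm1 (suc n) = inv! (suc n)

sumPS : ℕ → (ℕ → PS) → PS
sumPS m F = foldr (λ i acc → F i ⊕ acc) zeroPS (upTo m)

{-# OPTIONS --safe #-}
-- Two full linear terms induce the same operation iff their right-depth vectors agree mod k,
-- so the term operations correspond to the residue vectors of full linear terms. Right depths
-- have a unique 0 (at the leftmost variable) and no gaps, and conversely every such depth vector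
-- is realised by grafting the variables, layer by layer, onto the right spine. Hence the residue
-- vectors are those surjective onto {0,…,k−1} (when some depth reaches k−1), k!·S(n,k) of them,
-- and those with a single 0 whose other values are exactly {1,…,j} with j ≤ k−2,
-- n·j!·S(n−1,j) of them. For the series, j!·S(n,j)/n! is the coefficient of tⁿ in (eᵗ−1)ʲ by
-- binomial convolution, and multiplication by t shifts coefficients.

module Submission where

open import Defs
open import Data.Nat
  using (ℕ; zero; suc; _+_; _*_; _∸_; _≤_; _<_; _≤?_; z≤n; s≤s; ∣_-_∣; _!; pred; NonZero)
open import Data.Nat.Properties
  using (≤-total; ≤-trans; ≤-reflexive; ≤-pred; ≤-antisym; <-irrefl; <-trans; <-≤-trans; ≤-<-trans;
         n≤1+n; n<1+n; m≤m+n; m≤n+m; +-monoʳ-≤; +-identityʳ; +-assoc; +-comm; m+[n∸m]≡n;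
         m+n≡0⇒m≡0; m+n≡0⇒n≡0; n≤0⇒n≡0; m≤n⇒∣m-n∣≡n∸m; ∣-∣-comm; [m+n]∸[m+o]≡n∸o; *-distribʳ-∸;
         m≤n⇒m<n∨m≡n; <⇒≢; <⇒≤; 1+n≢0; ≰⇒>; <⇒≤pred; suc-pred; *-zeroʳ; *-identityˡ; *-distribʳ-+;
         *-distribˡ-+; +-∸-assoc; *-cancelʳ-≡; _!≢0; _!*_!≢0; m*n≢0)
  renaming (_≟_ to _≟ℕ_)
open import Data.Nat.DivMod using (_%_; _/_; m≡m%n+[m/n]*n; %-remove-+ʳ; m%n<n; m<n⇒m%n≡m; n%n≡0; m/n*n≡m)
open import Data.Nat.Divisibility using (_∣_; divides)
open import Data.Nat.Combinatorics using (_C_; nCk≡n!/k![n-k]!; k![n∸k]!∣n!; k>n⇒nCk≡0; nCk+nC[k+1]≡[n+1]C[k+1])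
open import Data.Nat.Tactic.RingSolver using (solve-∀)
import Data.Integer as ℤ
open import Data.Integer.Properties using (pos-*; pos-+)
open import Data.Rational as ℚ using (ℚ; 0ℚ; 1ℚ; fromℚᵘ; toℚᵘ)
import Data.Rational.Properties as ℚ
open import Data.Rational.Unnormalised as ℚᵘ using (mkℚᵘ; *≡*)
import Data.Rational.Unnormalised.Properties as ℚᵘ
open import Data.Fin using (Fin; zero; suc; punchIn; punchOut)
open import Data.Fin.Properties using (_≟_; any?; punchInᵢ≢i; punchOut-punchIn)
open import Data.Vec using (Vec; []; _∷_; lookup; tabulate; insertAt; removeAt)
open import Data.Vec.Properties
  using (∷-injective; ∷-injectiveʳ; lookup∘tabulate; tabulate-cong; tabulate∘lookup; insertAt-lookup;
         insertAt-punchIn; insertAt-removeAt; removeAt-insertAt; removeAt-punchOut)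
open import Data.List using (List; []; _∷_; length; map; foldr; _++_; concatMap; filter; upTo; applyUpTo; allFin)
open import Data.List.Properties
  using (length-map; length-++; length-upTo; length-applyUpTo; length-tabulate; length-removeAt′;
         filter-accept; filter-reject; filter-all)
open import Data.List.Extrema.Nat using (argmax; f[xs]≤f[argmax])
open import Data.List.Membership.Propositional using (_∈_; _∉_; _─_; lose; find)
open import Data.List.Membership.Propositional.Properties
  using (∈-map⁺; ∈-map⁻; ∈-++⁺ˡ; ∈-++⁺ʳ; ∈-++⁻; ∈-concatMap⁺; ∈-concatMap⁻; ∈-filter⁺; ∈-filter⁻;
         ∈-allFin; ∈-upTo⁺; ∈-upTo⁻; ∈-applyUpTo⁺; ∈-applyUpTo⁻)
open import Data.List.Relation.Unary.Any using (here; there; index)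
open import Data.List.Relation.Unary.All as All using (All; []; _∷_)
import Data.List.Relation.Unary.All.Properties as AllP
import Data.List.Relation.Unary.AllPairs as AllPairs
import Data.List.Relation.Unary.AllPairs.Properties as AllPairsP
open import Data.List.Relation.Unary.Unique.Propositional using (Unique; []; _∷_)
import Data.List.Relation.Unary.Unique.Propositional.Properties as Unique
open import Data.List.Relation.Binary.Disjoint.Propositional using (Disjoint)
open import Data.Product using (∃; ∃₂; _×_; _,_; proj₁; proj₂)
open import Data.Sum using (_⊎_; inj₁; inj₂)
open import Data.Unit using (tt)
open import Data.Empty using (⊥-elim)
open import Function using (_∘_; id)
open import Function.Bundles using (_⇔_; mk⇔; Equivalence)
import Function.Properties.Equivalence as ⇔
open import Relation.Nullary using (¬_; yes; no; ¬?)
open import Relation.Binary.PropositionalEquality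
open ≡-Reasoning

module _ {k : ℕ} .{{_ : NonZero k}} where

  ∣∸⇒%≡ : ∀ {a b} → a ≤ b → k ∣ b ∸ a → a % k ≡ b % k
  ∣∸⇒%≡ {a} {b} a≤b k∣b∸a = begin
    a % k             ≡⟨ %-remove-+ʳ a k∣b∸a ⟨
    (a + (b ∸ a)) % k ≡⟨ cong (_% k) (m+[n∸m]≡n a≤b) ⟩
    b % k             ∎

  %≡⇒∣∸ : ∀ {a b} → a % k ≡ b % k → k ∣ b ∸ a
  %≡⇒∣∸ {a} {b} eq = divides (b / k ∸ a / k) (begin
    b ∸ a                                     ≡⟨ cong₂ _∸_ (m≡m%n+[m/n]*n b k) (m≡m%n+[m/n]*n a k) ⟩
    (b % k + b / k * k) ∸ (a % k + a / k * k) ≡⟨ cong (λ x → (b % k + b / k * k) ∸ (x + a / k * k)) eq ⟩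
    (b % k + b / k * k) ∸ (b % k + a / k * k) ≡⟨ [m+n]∸[m+o]≡n∸o (b % k) (b / k * k) (a / k * k) ⟩
    b / k * k ∸ a / k * k                     ≡⟨ *-distribʳ-∸ k (b / k) (a / k) ⟨
    (b / k ∸ a / k) * k                       ∎)

  ≡[mod]⇔%≡ : ∀ a b → a ≡ b [mod k ] ⇔ a % k ≡ b % k
  ≡[mod]⇔%≡ a b with ≤-total a b
  ... | inj₁ a≤b = mk⇔ (λ k∣ → ∣∸⇒%≡ a≤b (subst (k ∣_) (m≤n⇒∣m-n∣≡n∸m a≤b) k∣))
                       (λ eq → subst (k ∣_) (sym (m≤n⇒∣m-n∣≡n∸m a≤b)) (%≡⇒∣∸ eq))
  ... | inj₂ b≤a = mk⇔ (λ k∣ → sym (∣∸⇒%≡ b≤a (subst (k ∣_) |a-b|≡a∸b k∣)))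
                       (λ eq → subst (k ∣_) (sym |a-b|≡a∸b) (%≡⇒∣∸ (sym eq)))
    where
    |a-b|≡a∸b : ∣ a - b ∣ ≡ a ∸ b
    |a-b|≡a∸b = trans (∣-∣-comm a b) (m≤n⇒∣m-n∣≡n∸m b≤a)

-- Right depths

module _ {n : ℕ} where

  occ-var-≡ : (i : Fin n) → occ (var i) i ≡ 1
  occ-var-≡ i with i ≟ i
  ... | yes _ = refl
  ... | no i≢i = ⊥-elim (i≢i refl)

  occ-var-≢ : {j i : Fin n} → j ≢ i → occ (var j) i ≡ 0
  occ-var-≢ {j} {i} j≢i with j ≟ i
  ... | yes j≡i = ⊥-elim (j≢i j≡i)
  ... | no _ = refl

  occ-var⇒≡ : {j i : Fin n} → 1 ≤ occ (var j) i → j ≡ i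
  occ-var⇒≡ {j} {i} _ with j ≟ i
  ... | yes j≡i = j≡i

  rdepth-·ˡ : ∀ (s t : Term n) {i} → 1 ≤ occ s i → rdepth (s · t) i ≡ rdepth s i
  rdepth-·ˡ s t {i} _ with occ s i
  ... | suc _ = refl

  rdepth-·ʳ : ∀ (s t : Term n) {i} → occ s i ≡ 0 → rdepth (s · t) i ≡ suc (rdepth t i)
  rdepth-·ʳ s t {i} occ≡0 with occ s i
  ... | zero = refl

  Linear : Term n → Set
  Linear t = ∀ i → occ t i ≤ 1

  FullLinear⇒Linear : ∀ {t : Term n} → FullLinear t → Linear t
  FullLinear⇒Linear full i = ≤-reflexive (full i)

  FullLinear⇒occurs : ∀ {t : Term n} → FullLinear t → ∀ i → 1 ≤ occ t i
  FullLinear⇒occurs full i = ≤-reflexive (sym (full i))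

  leftmost : Term n → Fin n
  leftmost (var x) = x
  leftmost (s · t) = leftmost s

  occ-leftmost : ∀ t → 1 ≤ occ t (leftmost t)
  occ-leftmost (var x) = ≤-reflexive (sym (occ-var-≡ x))
  occ-leftmost (s · t) = ≤-trans (occ-leftmost s) (m≤m+n _ _)

  rdepth-leftmost : ∀ t → rdepth t (leftmost t) ≡ 0
  rdepth-leftmost (var x) = refl
  rdepth-leftmost (s · t) = trans (rdepth-·ˡ s t (occ-leftmost s)) (rdepth-leftmost s)

  rdepth≡0⇒leftmost : ∀ t {i} → 1 ≤ occ t i → rdepth t i ≡ 0 → i ≡ leftmost t
  rdepth≡0⇒leftmost (var x) occ≥1 _ = sym (occ-var⇒≡ occ≥1)
  rdepth≡0⇒leftmost (s · t) {i} occ≥1 rdepth≡0 with occ s i in eq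
  ... | zero  = ⊥-elim (1+n≢0 rdepth≡0)
  ... | suc _ = rdepth≡0⇒leftmost s (subst (1 ≤_) (sym eq) (s≤s z≤n)) rdepth≡0

  rdepth-downClosed : ∀ t → Linear t → ∀ {i} → 1 ≤ occ t i → ∀ {e} → e ≤ rdepth t i →
                      ∃ λ j → 1 ≤ occ t j × rdepth t j ≡ e
  rdepth-downClosed (var x) _ {i} occ≥1 e≤0 = i , occ≥1 , sym (n≤0⇒n≡0 e≤0)
  rdepth-downClosed (s · t) lin {i} occ≥1 e≤ with occ s i in eq
  ... | suc _ with rdepth-downClosed s (λ j → ≤-trans (m≤m+n _ _) (lin j)) (subst (1 ≤_) (sym eq) (s≤s z≤n)) e≤
  ...   | j , s∋j , rdepth≡e = j , ≤-trans s∋j (m≤m+n _ _) , trans (rdepth-·ˡ s t s∋j) rdepth≡e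
  rdepth-downClosed (s · t) lin occ≥1 {zero} _ | zero =
    leftmost s , ≤-trans (occ-leftmost s) (m≤m+n _ _) , trans (rdepth-·ˡ s t (occ-leftmost s)) (rdepth-leftmost s)
  rdepth-downClosed (s · t) lin occ≥1 {suc e} (s≤s e≤) | zero
    with rdepth-downClosed t (λ j → ≤-trans (m≤n+m _ _) (lin j)) occ≥1 e≤
  ... | j , t∋j , rdepth≡e = j , ≤-trans t∋j (m≤n+m _ _) , trans (rdepth-·ʳ s t s∌j) (cong suc rdepth≡e)
    where
    s∌j : occ s j ≡ 0
    s∌j = n≤0⇒n≡0 (≤-pred (≤-trans (subst (_≤ occ s j + occ t j) (+-comm (occ s j) 1) (+-monoʳ-≤ (occ s j) t∋j))
                                   (lin j)))

-- Realising right depths by grafting onto the right spine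

module _ {n : ℕ} where

  rspine : Term n → ℕ
  rspine (var _) = 0
  rspine (s · t) = suc (rspine t)

  -- graft t e x replaces the subterm u at depth e of the right spine of t by u · var x;
  -- on a spine shorter than e it grafts below the last leaf.
  graft : Term n → ℕ → Fin n → Term n
  graft t       zero    x = t · var x
  graft (var y) (suc e) x = var y · var x
  graft (s · t) (suc e) x = s · graft t e x

  occ-graft : ∀ t e x i → occ (graft t e x) i ≡ occ t i + occ (var x) i
  occ-graft t       zero    x i = refl
  occ-graft (var y) (suc e) x i = refl
  occ-graft (s · t) (suc e) x i = trans (cong (occ s i +_) (occ-graft t e x i)) (sym (+-assoc (occ s i) _ _))

  rspine-graft : ∀ t {e} x → e ≤ rspine t → rspine (graft t e x) ≡ suc e
  rspine-graft t       {zero}  x _         = refl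
  rspine-graft (s · t) {suc e} x (s≤s e≤) = cong suc (rspine-graft t x e≤)

  rdepth-graft-new : ∀ t {e} x → e ≤ rspine t → occ t x ≡ 0 → rdepth (graft t e x) x ≡ suc e
  rdepth-graft-new t {zero} x _ t∌x rewrite t∌x = refl
  rdepth-graft-new (s · t) {suc e} x (s≤s e≤) s·t∌x =
    trans (rdepth-·ʳ s _ (m+n≡0⇒m≡0 (occ s x) s·t∌x))
          (cong suc (rdepth-graft-new t x e≤ (m+n≡0⇒n≡0 (occ s x) s·t∌x)))

  rdepth-graft-old : ∀ t e x {i} → 1 ≤ occ t i → rdepth (graft t e x) i ≡ rdepth t i
  rdepth-graft-old t zero x {i} _ with occ t i
  ... | suc _ = refl
  rdepth-graft-old (var y) (suc e) x {i} _ with occ (var y) i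
  ... | suc _ = refl
  rdepth-graft-old (s · t) (suc e) x {i} t∋i with occ s i
  ... | zero  = cong suc (rdepth-graft-old t e x t∋i)
  ... | suc _ = refl

  graftAll : Term n → ℕ → List (Fin n) → Term n
  graftAll t e []       = t
  graftAll t e (x ∷ xs) = graftAll (graft t e x) e xs

  multiplicity : Fin n → List (Fin n) → ℕ
  multiplicity i []       = 0
  multiplicity i (j ∷ js) = occ (var j) i + multiplicity i js

  occ-graftAll : ∀ t e xs i → occ (graftAll t e xs) i ≡ occ t i + multiplicity i xs
  occ-graftAll t e []       i = sym (+-identityʳ (occ t i))
  occ-graftAll t e (x ∷ xs) i = begin
    occ (graftAll (graft t e x) e xs) i                ≡⟨ occ-graftAll (graft t e x) e xs i ⟩
    occ (graft t e x) i + multiplicity i xs            ≡⟨ cong (_+ multiplicity i xs) (occ-graft t e x i) ⟩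
    occ t i + occ (var x) i + multiplicity i xs        ≡⟨ +-assoc (occ t i) _ _ ⟩
    occ t i + (occ (var x) i + multiplicity i xs)      ∎

  rdepth-graftAll-old : ∀ t e xs {i} → 1 ≤ occ t i → rdepth (graftAll t e xs) i ≡ rdepth t i
  rdepth-graftAll-old t e []       _   = refl
  rdepth-graftAll-old t e (x ∷ xs) t∋i =
    trans (rdepth-graftAll-old (graft t e x) e xs (subst (1 ≤_) (sym (occ-graft t e x _)) (≤-trans t∋i (m≤m+n _ _))))
          (rdepth-graft-old t e x t∋i)

  rdepth-graftAll-new : ∀ t {e} xs {i} → e ≤ rspine t → occ t i ≡ 0 → i ∈ xs → rdepth (graftAll t e xs) i ≡ suc e
  rdepth-graftAll-new t {e} (x ∷ xs) {i} e≤ t∌i i∈ with x ≟ i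
  ... | yes refl = trans (rdepth-graftAll-old (graft t e x) e xs t'∋x) (rdepth-graft-new t x e≤ t∌i)
    where
    t'∋x : 1 ≤ occ (graft t e x) x
    t'∋x = ≤-reflexive (sym (trans (occ-graft t e x x) (cong₂ _+_ t∌i (occ-var-≡ x))))
  ... | no x≢i with i∈
  ...   | here i≡x = ⊥-elim (x≢i (sym i≡x))
  ...   | there i∈xs = rdepth-graftAll-new (graft t e x) xs (subst (e ≤_) (sym (rspine-graft t x e≤)) (n≤1+n e)) t'∌i i∈xs
    where
    t'∌i : occ (graft t e x) i ≡ 0
    t'∌i = trans (occ-graft t e x i) (cong₂ _+_ t∌i (occ-var-≢ x≢i))

  rspine-graftAll : ∀ t {e} x xs → e ≤ rspine t → rspine (graftAll t e (x ∷ xs)) ≡ suc e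
  rspine-graftAll t {e} x []        e≤ = rspine-graft t x e≤
  rspine-graftAll t {e} x (y ∷ xs) e≤ =
    rspine-graftAll (graft t e x) y xs (subst (e ≤_) (sym (rspine-graft t x e≤)) (n≤1+n e))

  multiplicity-∉ : ∀ {i} xs → i ∉ xs → multiplicity i xs ≡ 0
  multiplicity-∉ []       _   = refl
  multiplicity-∉ (x ∷ xs) i∉ =
    cong₂ _+_ (occ-var-≢ (λ x≡i → i∉ (here (sym x≡i)))) (multiplicity-∉ xs (i∉ ∘ there))

  multiplicity-∈ : ∀ {i xs} → Unique xs → i ∈ xs → multiplicity i xs ≡ 1
  multiplicity-∈ {i} {x ∷ xs} (x∉xs ∷ _) (here refl) =
    cong₂ _+_ (occ-var-≡ i) (multiplicity-∉ xs (λ i∈xs → All.lookup x∉xs i∈xs refl))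
  multiplicity-∈ {i} {x ∷ xs} (x∉xs ∷ xs!) (there i∈xs) =
    cong₂ _+_ (occ-var-≢ (λ x≡i → All.lookup x∉xs i∈xs x≡i)) (multiplicity-∈ xs! i∈xs)

module Realise {n : ℕ} (d : Fin n → ℕ) (z : Fin n)
               (d[z]≡0 : d z ≡ 0) (d≡0⇒z : ∀ i → d i ≡ 0 → i ≡ z)
               (d-downClosed : ∀ i {e} → e ≤ d i → ∃ λ j → d j ≡ e) where

  layer : ℕ → List (Fin n)
  layer e = filter (λ j → d j ≟ℕ e) (allFin n)

  ∈-layer : ∀ {i e} → d i ≡ e → i ∈ layer e
  ∈-layer {i} {e} = ∈-filter⁺ (λ j → d j ≟ℕ e) {xs = allFin n} (∈-allFin i)

  multiplicity-layer-≡ : ∀ {i e} → d i ≡ e → multiplicity i (layer e) ≡ 1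
  multiplicity-layer-≡ {e = e} d[i]≡e =
    multiplicity-∈ (Unique.filter⁺ (λ j → d j ≟ℕ e) (Unique.allFin⁺ n)) (∈-layer d[i]≡e)

  multiplicity-layer-≢ : ∀ {i e} → d i ≢ e → multiplicity i (layer e) ≡ 0
  multiplicity-layer-≢ {e = e} d[i]≢e =
    multiplicity-∉ (layer e) (λ i∈ → d[i]≢e (proj₂ (∈-filter⁻ (λ j → d j ≟ℕ e) {xs = allFin n} i∈)))

  build : ℕ → Term n
  build zero    = var z
  build (suc e) = graftAll (build e) e (layer (suc e))

  occ-build-> : ∀ {i} e → e < d i → occ (build e) i ≡ 0
  occ-build-> {i} zero    0<d[i] = occ-var-≢ (λ z≡i → <⇒≢ 0<d[i] (sym (trans (cong d (sym z≡i)) d[z]≡0)))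
  occ-build-> {i} (suc e) e<d[i] = begin
    occ (build (suc e)) i                            ≡⟨ occ-graftAll (build e) e (layer (suc e)) i ⟩
    occ (build e) i + multiplicity i (layer (suc e)) ≡⟨ cong₂ _+_ (occ-build-> e (<-trans (n<1+n e) e<d[i]))
                                                                  (multiplicity-layer-≢ (λ eq → <⇒≢ e<d[i] (sym eq))) ⟩
    0                                                ∎

  occ-build-≤ : ∀ {i} e → d i ≤ e → occ (build e) i ≡ 1
  occ-build-≤ {i} zero    d[i]≤0 = subst (λ j → occ (var j) i ≡ 1) (d≡0⇒z i (n≤0⇒n≡0 d[i]≤0)) (occ-var-≡ i)
  occ-build-≤ {i} (suc e) d[i]≤ = trans (occ-graftAll (build e) e (layer (suc e)) i) (step (m≤n⇒m<n∨m≡n d[i]≤))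
    where
    step : d i < suc e ⊎ d i ≡ suc e → occ (build e) i + multiplicity i (layer (suc e)) ≡ 1
    step (inj₁ d[i]≤e) = cong₂ _+_ (occ-build-≤ e (≤-pred d[i]≤e)) (multiplicity-layer-≢ (<⇒≢ d[i]≤e))
    step (inj₂ d[i]≡) = cong₂ _+_ (occ-build-> e (subst (e <_) (sym d[i]≡) (n<1+n e))) (multiplicity-layer-≡ d[i]≡)

  rspine-build : ∀ {i} e → d i ≡ e → rspine (build e) ≡ e
  rspine-build zero    _       = refl
  rspine-build {i} (suc e) d[i]≡ with d-downClosed i (subst (e ≤_) (sym d[i]≡) (n≤1+n e))
  ... | j , d[j]≡e with layer (suc e) | ∈-layer d[i]≡
  ...   | x ∷ xs | _ = rspine-graftAll (build e) x xs (≤-reflexive (sym (rspine-build e d[j]≡e)))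

  rdepth-build : ∀ {i} e → d i ≤ e → rdepth (build e) i ≡ d i
  rdepth-build zero d[i]≤0 = sym (n≤0⇒n≡0 d[i]≤0)
  rdepth-build {i} (suc e) d[i]≤ with m≤n⇒m<n∨m≡n d[i]≤
  ... | inj₁ d[i]≤e =
    trans (rdepth-graftAll-old (build e) e (layer (suc e)) (≤-reflexive (sym (occ-build-≤ e (≤-pred d[i]≤e)))))
          (rdepth-build e (≤-pred d[i]≤e))
  ... | inj₂ d[i]≡ with d-downClosed i (subst (e ≤_) (sym d[i]≡) (n≤1+n e))
  ...   | j , d[j]≡e = trans (rdepth-graftAll-new (build e) (layer (suc e)) (≤-reflexive (sym (rspine-build e d[j]≡e)))
                                 (occ-build-> e (subst (e <_) (sym d[i]≡) (n<1+n e)))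
                                 (∈-layer d[i]≡))
                             (sym d[i]≡)

  build-realises : ∀ e → (∀ i → d i ≤ e) → FullLinear (build e) × (∀ i → rdepth (build e) i ≡ d i)
  build-realises e d≤e = (λ i → occ-build-≤ e (d≤e i)) , (λ i → rdepth-build e (d≤e i))

-- Enumerating surjections

module _ {A B : Set} where

  Unique-concatMap : ∀ {f : A → List B} {xs} → Unique xs → (∀ {x} → x ∈ xs → Unique (f x)) →
                     (∀ {x y} → x ≢ y → Disjoint (f x) (f y)) → Unique (concatMap f xs)
  Unique-concatMap xs! f! disjoint = Unique.concat⁺ (AllP.map⁺ (All.tabulate f!)) (AllPairsP.map⁺ (AllPairs.map disjoint xs!))

  length-concatMap : ∀ (f : A → List B) (g : A → ℕ) c xs → (∀ {x} → x ∈ xs → length (f x) ≡ c * g x) →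
                     length (concatMap f xs) ≡ c * foldr (λ x acc → g x + acc) 0 xs
  length-concatMap f g c []       _   = sym (*-zeroʳ c)
  length-concatMap f g c (x ∷ xs) len = begin
    length (f x ++ concatMap f xs)                    ≡⟨ length-++ (f x) ⟩
    length (f x) + length (concatMap f xs)            ≡⟨ cong₂ _+_ (len (here refl)) (length-concatMap f g c xs (len ∘ there)) ⟩
    c * g x + c * foldr (λ x acc → g x + acc) 0 xs    ≡⟨ *-distribˡ-+ c (g x) _ ⟨
    c * (g x + foldr (λ x acc → g x + acc) 0 xs)      ∎

  length-concatMap-const : ∀ (f : A → List B) c xs → (∀ {x} → x ∈ xs → length (f x) ≡ c) →
                           length (concatMap f xs) ≡ length xs * c
  length-concatMap-const f c []       _   = refl
  length-concatMap-const f c (x ∷ xs) len =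
    trans (length-++ (f x)) (cong₂ _+_ (len (here refl)) (length-concatMap-const f c xs (λ x∈ → len (there x∈))))

module _ {A : Set} where

  ∈-─⁺ : ∀ {x y : A} {xs} (x∈xs : x ∈ xs) → y ∈ xs → y ≢ x → y ∈ xs ─ x∈xs
  ∈-─⁺ (here refl) (here refl) y≢x = ⊥-elim (y≢x refl)
  ∈-─⁺ (here refl) (there y∈)  _   = y∈
  ∈-─⁺ (there _)   (here refl) _   = here refl
  ∈-─⁺ (there x∈)  (there y∈)  y≢x = there (∈-─⁺ x∈ y∈ y≢x)

  Unique-⊆⇒length≤ : ∀ {xs ys : List A} → Unique xs → (∀ {x} → x ∈ xs → x ∈ ys) → length xs ≤ length ys
  Unique-⊆⇒length≤ {[]}     _             _     = z≤n
  Unique-⊆⇒length≤ {x ∷ xs} {ys} (x∉xs ∷ xs!) xs⊆ys =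
    subst (suc (length xs) ≤_) (sym (length-removeAt′ ys (index x∈ys)))
      (s≤s (Unique-⊆⇒length≤ xs! λ y∈xs →
         ∈-─⁺ x∈ys (xs⊆ys (there y∈xs)) (λ y≡x → All.lookup x∉xs y∈xs (sym y≡x))))
    where
    x∈ys = xs⊆ys (here refl)

surjectionCount : ℕ → ℕ → ℕ
surjectionCount n k = k ! * S n k

surjectionCount-suc : ∀ n k → k * (surjectionCount n k + surjectionCount n (pred k)) ≡ surjectionCount (suc n) k
surjectionCount-suc n zero    = refl
surjectionCount-suc n (suc k) = lemma k (k !) (S n (suc k)) (S n k)
  where
  lemma : ∀ k f x y → suc k * ((suc k * f) * x + f * y) ≡ (suc k * f) * (suc k * x + y)
  lemma = solve-∀

SurjectiveOn : ∀ {n} → List ℕ → Vec ℕ n → Set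
SurjectiveOn A r = (∀ i → lookup r i ∈ A) × (∀ {a} → a ∈ A → ∃ λ i → lookup r i ≡ a)

_without_ : List ℕ → ℕ → List ℕ
A without b = filter (λ a → ¬? (a ≟ℕ b)) A

module _ {A : List ℕ} {b : ℕ} where

  ∈-without⁺ : ∀ {a} → a ∈ A → a ≢ b → a ∈ A without b
  ∈-without⁺ = ∈-filter⁺ (λ a → ¬? (a ≟ℕ b))

  ∈-without⁻ : ∀ {a} → a ∈ A without b → a ∈ A × a ≢ b
  ∈-without⁻ = ∈-filter⁻ (λ a → ¬? (a ≟ℕ b))

  Unique-without : Unique A → Unique (A without b)
  Unique-without = Unique.filter⁺ (λ a → ¬? (a ≟ℕ b))

length-without : ∀ {A b} → Unique A → b ∈ A → suc (length (A without b)) ≡ length A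
length-without {b ∷ A} {b} (b∉A ∷ _) (here refl) =
  cong (suc ∘ length) (trans (filter-reject (λ a → ¬? (a ≟ℕ b)) (λ b≢b → b≢b refl))
                             (filter-all (λ a → ¬? (a ≟ℕ b)) (All.map (λ b≢a a≡b → b≢a (sym a≡b)) b∉A)))
length-without {a ∷ A} {b} (a∉A ∷ A!) (there b∈A) =
  trans (cong (suc ∘ length) (filter-accept (λ a → ¬? (a ≟ℕ b)) (λ a≡b → All.lookup a∉A b∈A a≡b)))
        (cong suc (length-without A! b∈A))

Disjoint-map-∷ : ∀ {n} {x y : ℕ} {X Y : List (Vec ℕ n)} → x ≢ y → Disjoint (map (x ∷_) X) (map (y ∷_) Y)
Disjoint-map-∷ x≢y (v∈X , v∈Y) with ∈-map⁻ _ v∈X | ∈-map⁻ _ v∈Y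
... | _ , _ , refl | _ , _ , eq = x≢y (proj₁ (∷-injective eq))

surjections : ∀ n → List ℕ → List (Vec ℕ n)
surjections zero    []      = [] ∷ []
surjections zero    (_ ∷ _) = []
surjections (suc n) A       = concatMap (λ b → map (b ∷_) (surjections n A ++ surjections n (A without b))) A

∈-surjections⁻ : ∀ n A {r : Vec ℕ n} → r ∈ surjections n A → SurjectiveOn A r
∈-surjections⁻ zero [] (here refl) = (λ ()) , (λ ())
∈-surjections⁻ (suc n) A {a ∷ w} r∈
  with find (∈-concatMap⁻ (λ b → map (b ∷_) (surjections n A ++ surjections n (A without b))) {xs = A} r∈)
... | b , b∈A , r∈b∷ with ∈-map⁻ (b ∷_) r∈b∷
...   | w′ , w′∈ , a∷w≡b∷w′ with ∷-injective a∷w≡b∷w′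
...     | refl , refl with ∈-++⁻ (surjections n A) w′∈
...       | inj₁ w∈ = values , onto
  where
  values : ∀ i → lookup (a ∷ w) i ∈ A
  values zero    = b∈A
  values (suc i) = proj₁ (∈-surjections⁻ n A w∈) i
  onto : ∀ {c} → c ∈ A → ∃ λ i → lookup (a ∷ w) i ≡ c
  onto c∈A = let i , w[i]≡c = proj₂ (∈-surjections⁻ n A w∈) c∈A in suc i , w[i]≡c
...       | inj₂ w∈ = values , onto
  where
  values : ∀ i → lookup (a ∷ w) i ∈ A
  values zero    = b∈A
  values (suc i) = proj₁ (∈-without⁻ (proj₁ (∈-surjections⁻ n (A without a) w∈) i))
  onto : ∀ {c} → c ∈ A → ∃ λ i → lookup (a ∷ w) i ≡ c
  onto {c} c∈A with c ≟ℕ a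
  ... | yes refl = zero , refl
  ... | no c≢a   = let i , w[i]≡c = proj₂ (∈-surjections⁻ n (A without a) w∈) (∈-without⁺ c∈A c≢a) in suc i , w[i]≡c

∈-surjections⁺ : ∀ n A {r : Vec ℕ n} → SurjectiveOn A r → r ∈ surjections n A
∈-surjections⁺ zero [] {[]} _ = here refl
∈-surjections⁺ zero (a ∷ A) {[]} (_ , onto) with onto (here refl)
... | () , _
∈-surjections⁺ (suc n) A {a ∷ w} (values , onto) =
  ∈-concatMap⁺ (λ b → map (b ∷_) (surjections n A ++ surjections n (A without b)))
               (lose (values zero) (∈-map⁺ (a ∷_) tail∈))
  where
  tail∈ : w ∈ surjections n A ++ surjections n (A without a)
  tail∈ with any? (λ i → lookup w i ≟ℕ a)
  ... | yes (j , w[j]≡a) = ∈-++⁺ˡ (∈-surjections⁺ n A (values ∘ suc , onto′))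
    where
    onto′ : ∀ {c} → c ∈ A → ∃ λ i → lookup w i ≡ c
    onto′ c∈A with onto c∈A
    ... | zero  , a≡c    = j , trans w[j]≡a a≡c
    ... | suc i , w[i]≡c = i , w[i]≡c
  ... | no a∉w = ∈-++⁺ʳ (surjections n A) (∈-surjections⁺ n (A without a) (values′ , onto′))
    where
    values′ : ∀ i → lookup w i ∈ A without a
    values′ i = ∈-without⁺ (values (suc i)) (λ w[i]≡a → a∉w (i , w[i]≡a))
    onto′ : ∀ {c} → c ∈ A without a → ∃ λ i → lookup w i ≡ c
    onto′ c∈ with ∈-without⁻ c∈
    ... | c∈A , c≢a with onto c∈A
    ...   | zero  , a≡c    = ⊥-elim (c≢a (sym a≡c))
    ...   | suc i , w[i]≡c = i , w[i]≡c

Unique-surjections : ∀ n {A} → Unique A → Unique (surjections n A)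
Unique-surjections zero    {[]}    _  = All.[] ∷ []
Unique-surjections zero    {_ ∷ _} _  = []
Unique-surjections (suc n) {A}     A! = Unique-concatMap A! tails! Disjoint-map-∷
  where
  tails! : ∀ {b} → b ∈ A → Unique (map (b ∷_) (surjections n A ++ surjections n (A without b)))
  tails! {b} b∈A = Unique.map⁺ ∷-injectiveʳ
    (Unique.++⁺ (Unique-surjections n A!) (Unique-surjections n (Unique-without A!)) λ (w∈ , w∈′) →
      let i , w[i]≡b = proj₂ (∈-surjections⁻ n A w∈) b∈A
      in proj₂ (∈-without⁻ {A} {b} (proj₁ (∈-surjections⁻ n (A without b) w∈′) i)) w[i]≡b)

length-surjections : ∀ n {A} → Unique A → length (surjections n A) ≡ surjectionCount n (length A)
length-surjections zero    {[]}    _  = refl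
length-surjections zero    {a ∷ A} _  = sym (*-zeroʳ (length (a ∷ A) !))
length-surjections (suc n) {A}     A! = begin
  length (surjections (suc n) A)
    ≡⟨ length-concatMap-const _ _ A tails ⟩
  length A * (surjectionCount n (length A) + surjectionCount n (pred (length A)))
    ≡⟨ surjectionCount-suc n (length A) ⟩
  surjectionCount (suc n) (length A) ∎
  where
  tails : ∀ {b} → b ∈ A → length (map (b ∷_) (surjections n A ++ surjections n (A without b)))
                          ≡ surjectionCount n (length A) + surjectionCount n (pred (length A))
  tails {b} b∈A = begin
    length (map (b ∷_) (surjections n A ++ surjections n (A without b)))
      ≡⟨ length-map (b ∷_) (surjections n A ++ _) ⟩
    length (surjections n A ++ surjections n (A without b))
      ≡⟨ length-++ (surjections n A) ⟩
    length (surjections n A) + length (surjections n (A without b))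
      ≡⟨ cong₂ _+_ (length-surjections n A!) (length-surjections n (Unique-without A!)) ⟩
    surjectionCount n (length A) + surjectionCount n (length (A without b))
      ≡⟨ cong (λ l → surjectionCount n (length A) + surjectionCount n (pred l)) (length-without A! b∈A) ⟩
    surjectionCount n (length A) + surjectionCount n (pred (length A)) ∎

lookup-insertAt-≢ : ∀ {n} (w : Vec ℕ n) {z i} v (z≢i : z ≢ i) → lookup (insertAt w z v) i ≡ lookup w (punchOut z≢i)
lookup-insertAt-≢ w {z} {i} v z≢i = begin
  lookup (insertAt w z v) i                         ≡⟨ removeAt-punchOut (insertAt w z v) z≢i ⟨
  lookup (removeAt (insertAt w z v) z) (punchOut z≢i) ≡⟨ cong (λ u → lookup u (punchOut z≢i)) (removeAt-insertAt w z v) ⟩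
  lookup w (punchOut z≢i)                           ∎

UniqueZeroOn : ∀ {n} → List ℕ → Vec ℕ (suc n) → Set
UniqueZeroOn A r = ∃₂ λ z w → SurjectiveOn A w × r ≡ insertAt w z 0

uniqueZeros : ∀ n → List ℕ → List (Vec ℕ (suc n))
uniqueZeros n A = concatMap (λ z → map (λ w → insertAt w z 0) (surjections n A)) (allFin (suc n))

∈-uniqueZeros⁻ : ∀ n A {r} → r ∈ uniqueZeros n A → UniqueZeroOn A r
∈-uniqueZeros⁻ n A r∈
  with find (∈-concatMap⁻ (λ z → map (λ w → insertAt w z 0) (surjections n A)) {xs = allFin (suc n)} r∈)
... | z , _ , r∈z with ∈-map⁻ (λ w → insertAt w z 0) r∈z
...   | w , w∈ , r≡ = z , w , ∈-surjections⁻ n A w∈ , r≡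

∈-uniqueZeros⁺ : ∀ n A {r} → UniqueZeroOn A r → r ∈ uniqueZeros n A
∈-uniqueZeros⁺ n A (z , w , w-onto , refl) =
  ∈-concatMap⁺ (λ z → map (λ w → insertAt w z 0) (surjections n A))
               (lose (∈-allFin z) (∈-map⁺ (λ w → insertAt w z 0) (∈-surjections⁺ n A w-onto)))

Unique-uniqueZeros : ∀ n {A} → Unique A → 0 ∉ A → Unique (uniqueZeros n A)
Unique-uniqueZeros n {A} A! 0∉A = Unique-concatMap (Unique.allFin⁺ (suc n))
  (λ {z} _ → Unique.map⁺ (λ {w} {w′} eq → trans (sym (removeAt-insertAt w z 0))
                                                (trans (cong (λ u → removeAt u z) eq) (removeAt-insertAt w′ z 0)))
                          (Unique-surjections n A!))
  disjoint
  where
  disjoint : ∀ {z z′} → z ≢ z′ →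
             Disjoint (map (λ w → insertAt w z 0) (surjections n A)) (map (λ w → insertAt w z′ 0) (surjections n A))
  disjoint {z} {z′} z≢z′ (v∈ , v∈′) with ∈-map⁻ _ v∈ | ∈-map⁻ _ v∈′
  ... | w , w∈ , refl | w′ , _ , eq = 0∉A (subst (_∈ A) zero-at-z′ (proj₁ (∈-surjections⁻ n A w∈) (punchOut z≢z′)))
    where
    zero-at-z′ : lookup w (punchOut z≢z′) ≡ 0
    zero-at-z′ = trans (sym (lookup-insertAt-≢ w 0 z≢z′)) (trans (cong (λ u → lookup u z′) eq) (insertAt-lookup w′ z′ 0))

length-uniqueZeros : ∀ n A → length (uniqueZeros n A) ≡ suc n * length (surjections n A)
length-uniqueZeros n A =
  trans (length-concatMap-const (λ z → map (λ w → insertAt w z 0) (surjections n A)) (length (surjections n A)) (allFin (suc n))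
                                (λ {z} _ → length-map (λ w → insertAt w z 0) (surjections n A)))
        (cong (_* length (surjections n A)) (length-tabulate {A = Fin (suc n)} (λ i → i)))

-- Admissible residue vectors

0∉positives : ∀ j → 0 ∉ applyUpTo suc j
0∉positives j 0∈ with ∈-applyUpTo⁻ suc 0∈
... | _ , _ , ()

∈-positives⁻ : ∀ {j a} → a ∈ applyUpTo suc j → ∃ λ b → b < j × a ≡ suc b
∈-positives⁻ = ∈-applyUpTo⁻ suc

Unique-positives : ∀ j → Unique (applyUpTo suc j)
Unique-positives j = Unique.applyUpTo⁺₁ suc j (λ i<j _ → <⇒≢ (s≤s i<j) )

lookup-removeAt : ∀ {n} (r : Vec ℕ (suc n)) z (j : Fin n) → lookup (removeAt r z) j ≡ lookup r (punchIn z j)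
lookup-removeAt r z j =
  trans (cong (lookup (removeAt r z)) (sym (punchOut-punchIn z))) (removeAt-punchOut r (punchInᵢ≢i z j ∘ sym))

UniqueZeroOn-≤ : ∀ {n j} {r : Vec ℕ (suc n)} → UniqueZeroOn (applyUpTo suc j) r → ∀ i → lookup r i ≤ j
UniqueZeroOn-≤ (z , w , (values , _) , refl) i with z ≟ i
... | yes refl = subst (_≤ _) (sym (insertAt-lookup w z 0)) z≤n
... | no z≢i with ∈-positives⁻ (values (punchOut z≢i))
...   | b , b<j , w≡ = ≤-trans (≤-reflexive (trans (lookup-insertAt-≢ w 0 z≢i) w≡)) b<j

UniqueZeroOn-attains : ∀ {n A} {r : Vec ℕ (suc n)} → UniqueZeroOn A r → ∀ {a} → a ∈ A → ∃ λ i → lookup r i ≡ a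
UniqueZeroOn-attains (z , w , (_ , onto) , refl) a∈A =
  let p , w[p]≡a = onto a∈A in punchIn z p , trans (insertAt-punchIn w z 0 p) w[p]≡a

UniqueZeroOn-≡ : ∀ {n j j′} {r : Vec ℕ (suc n)} →
                 UniqueZeroOn (applyUpTo suc j) r → UniqueZeroOn (applyUpTo suc j′) r → j ≡ j′
UniqueZeroOn-≡ {j = j} {j′} uz uz′ = ≤-antisym (bound uz uz′) (bound uz′ uz)
  where
  bound : ∀ {j j′} {r : Vec ℕ _} → UniqueZeroOn (applyUpTo suc j) r → UniqueZeroOn (applyUpTo suc j′) r → j ≤ j′
  bound {zero}  _  _   = z≤n
  bound {suc j} uz uz′ = let i , r[i]≡ = UniqueZeroOn-attains uz (∈-applyUpTo⁺ suc (n<1+n j))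
                         in subst (_≤ _) r[i]≡ (UniqueZeroOn-≤ uz′ i)

module Residues (k : ℕ) .{{_ : NonZero k}} where

  residues : ∀ {n} → Term n → Vec ℕ n
  residues t = tabulate (λ i → rdepth t i % k)

  lookup-residues : ∀ {n} (t : Term n) i → lookup (residues t) i ≡ rdepth t i % k
  lookup-residues t = lookup∘tabulate (λ i → rdepth t i % k)

  ≡[mod]⇔residues≡ : ∀ {n} (s t : Term n) → ((i : Fin n) → rdepth s i ≡ rdepth t i [mod k ]) ⇔ residues s ≡ residues t
  ≡[mod]⇔residues≡ s t = mk⇔
    (λ s≡t → tabulate-cong (λ i → Equivalence.to (≡[mod]⇔%≡ (rdepth s i) (rdepth t i)) (s≡t i)))
    (λ eq i → Equivalence.from (≡[mod]⇔%≡ (rdepth s i) (rdepth t i))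
                (trans (sym (lookup-residues s i)) (trans (cong (λ r → lookup r i) eq) (lookup-residues t i))))

  Admissible : ∀ {m} → Vec ℕ (suc m) → Set
  Admissible r = SurjectiveOn (upTo k) r ⊎ ∃ λ j → j < pred k × UniqueZeroOn (applyUpTo suc j) r

  pred[k]<k : pred k < k
  pred[k]<k = subst (pred k <_) (suc-pred k) (n<1+n (pred k))

  residues-admissible : ∀ {m} (t : Term (suc m)) → FullLinear t → Admissible (residues t)
  residues-admissible {m} t full with any? (λ i → pred k ≤? rdepth t i)
  ... | yes (i , pred[k]≤) = inj₁ (values , onto)
    where
    values : ∀ i → lookup (residues t) i ∈ upTo k
    values i = ∈-upTo⁺ (subst (_< k) (sym (lookup-residues t i)) (m%n<n (rdepth t i) k))
    onto : ∀ {c} → c ∈ upTo k → ∃ λ j → lookup (residues t) j ≡ c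
    onto c∈ with rdepth-downClosed t (FullLinear⇒Linear {t = t} full) {i} (FullLinear⇒occurs {t = t} full i)
                                   (≤-trans (<⇒≤pred (∈-upTo⁻ c∈)) pred[k]≤)
    ... | j , _ , rdepth≡c = j , trans (lookup-residues t j) (trans (cong (_% k) rdepth≡c) (m<n⇒m%n≡m (∈-upTo⁻ c∈)))
  ... | no shallow = inj₂ (M , M<pred[k] , z , removeAt r z , (values , onto) , r≡)
    where
    r = residues t
    z = leftmost t
    deepest = argmax (rdepth t) z (allFin (suc m))
    M = rdepth t deepest
    depth<pred[k] : ∀ i → rdepth t i < pred k
    depth<pred[k] i = ≰⇒> (λ le → shallow (i , le))
    M<pred[k] : M < pred k
    M<pred[k] = depth<pred[k] deepest
    depth≤M : ∀ i → rdepth t i ≤ M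
    depth≤M i = All.lookup (f[xs]≤f[argmax] {f = rdepth t} z (allFin (suc m))) (∈-allFin i)
    r≡depth : ∀ i → lookup r i ≡ rdepth t i
    r≡depth i = trans (lookup-residues t i) (m<n⇒m%n≡m (<-≤-trans (depth<pred[k] i) (<⇒≤ pred[k]<k)))
    r≡ : r ≡ insertAt (removeAt r z) z 0
    r≡ = sym (trans (cong (insertAt (removeAt r z) z) (sym (trans (r≡depth z) (rdepth-leftmost t)))) (insertAt-removeAt r z))
    values : ∀ j → lookup (removeAt r z) j ∈ applyUpTo suc M
    values j with rdepth t (punchIn z j) in eq
    ... | zero = ⊥-elim (punchInᵢ≢i z j (rdepth≡0⇒leftmost t (FullLinear⇒occurs {t = t} full _) eq))
    ... | suc b = subst (_∈ applyUpTo suc M) (sym (trans (lookup-removeAt r z j) (trans (r≡depth _) eq)))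
                        (∈-applyUpTo⁺ suc (subst (_≤ M) eq (depth≤M (punchIn z j))))
    onto : ∀ {a} → a ∈ applyUpTo suc M → ∃ λ j → lookup (removeAt r z) j ≡ a
    onto a∈ with ∈-positives⁻ a∈
    ... | b , b<M , refl
      with rdepth-downClosed t (FullLinear⇒Linear {t = t} full) {deepest} (FullLinear⇒occurs {t = t} full deepest) b<M
    ...   | i , _ , rdepth≡ = punchOut z≢i , trans (removeAt-punchOut r z≢i) (trans (r≡depth i) rdepth≡)
      where
      z≢i : z ≢ i
      z≢i z≡i = 1+n≢0 (trans (sym rdepth≡) (trans (cong (rdepth t) (sym z≡i)) (rdepth-leftmost t)))

  realise : ∀ {n} (r : Vec ℕ n) (d : Fin n → ℕ) z → d z ≡ 0 → (∀ i → d i ≡ 0 → i ≡ z) →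
            (∀ i {e} → e ≤ d i → ∃ λ j → d j ≡ e) → (∀ i → d i ≤ k) → (∀ i → d i % k ≡ lookup r i) →
            ∃ λ t → FullLinear t × residues t ≡ r
  realise r d z d[z]≡0 d≡0⇒z d-downClosed d≤k d≡r =
    build k , proj₁ realised ,
    trans (tabulate-cong (λ i → trans (cong (_% k) (proj₂ realised i)) (d≡r i))) (tabulate∘lookup r)
    where
    open Realise d z d[z]≡0 d≡0⇒z d-downClosed
    realised = build-realises k d≤k

  -- a residue 0 away from the leftmost variable is realised at depth k
  depthFor : ℕ → ℕ
  depthFor zero    = k
  depthFor (suc a) = suc a

  0<k : 0 < k
  0<k = subst (0 <_) (suc-pred k) (s≤s z≤n)

  depthFor-≤ : ∀ {a} → a < k → depthFor a ≤ k
  depthFor-≤ {zero}  _   = ≤-reflexive refl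
  depthFor-≤ {suc a} a<k = <⇒≤ a<k

  depthFor-% : ∀ {a} → a < k → depthFor a % k ≡ a
  depthFor-% {zero}  _   = n%n≡0 k
  depthFor-% {suc a} a<k = m<n⇒m%n≡m a<k

  surjective-realisable : ∀ {n} (r : Vec ℕ n) → SurjectiveOn (upTo k) r → ∃ λ t → FullLinear t × residues t ≡ r
  surjective-realisable r (values , onto) with onto (∈-upTo⁺ 0<k)
  ... | z , r[z]≡0 = realise r d z d[z]≡0 d≡0⇒z d-downClosed d≤k d≡r
    where
    d : _ → ℕ
    d i with i ≟ z
    ... | yes _ = 0
    ... | no _  = depthFor (lookup r i)
    d[z]≡0 : d z ≡ 0
    d[z]≡0 with z ≟ z
    ... | yes _  = refl
    ... | no z≢z = ⊥-elim (z≢z refl)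
    d≡depthFor : ∀ {i} → i ≢ z → d i ≡ depthFor (lookup r i)
    d≡depthFor {i} i≢z with i ≟ z
    ... | yes i≡z = ⊥-elim (i≢z i≡z)
    ... | no _    = refl
    depthFor≢0 : ∀ a → depthFor a ≢ 0
    depthFor≢0 zero    = <⇒≢ 0<k ∘ sym
    depthFor≢0 (suc a) = 1+n≢0
    d≡0⇒z : ∀ i → d i ≡ 0 → i ≡ z
    d≡0⇒z i d[i]≡0 with i ≟ z
    ... | yes i≡z = i≡z
    ... | no _    = ⊥-elim (depthFor≢0 (lookup r i) d[i]≡0)
    d≤k : ∀ i → d i ≤ k
    d≤k i with i ≟ z
    ... | yes _ = z≤n
    ... | no _  = depthFor-≤ (∈-upTo⁻ (values i))
    d≡r : ∀ i → d i % k ≡ lookup r i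
    d≡r i with i ≟ z
    ... | yes refl = trans (m<n⇒m%n≡m 0<k) (sym r[z]≡0)
    ... | no _     = depthFor-% (∈-upTo⁻ (values i))
    d-downClosed : ∀ i {e} → e ≤ d i → ∃ λ j → d j ≡ e
    d-downClosed i {zero}  _ = z , d[z]≡0
    d-downClosed i {suc e} e<d[i] with m≤n⇒m<n∨m≡n (≤-trans e<d[i] (d≤k i))
    ... | inj₂ 1+e≡k = i , trans (≤-antisym (d≤k i) (subst (_≤ d i) 1+e≡k e<d[i])) (sym 1+e≡k)
    ... | inj₁ 1+e<k with onto (∈-upTo⁺ 1+e<k)
    ...   | j , r[j]≡ = j , trans (d≡depthFor j≢z) (cong depthFor r[j]≡)
      where
      j≢z : j ≢ z
      j≢z refl = 1+n≢0 (trans (sym r[j]≡) r[z]≡0)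

  uniqueZero-realisable : ∀ {m j} (r : Vec ℕ (suc m)) → j < k → UniqueZeroOn (applyUpTo suc j) r →
                          ∃ λ t → FullLinear t × residues t ≡ r
  uniqueZero-realisable {j = j} r j<k uz@(z , w , (values , _) , refl) =
    realise r (lookup r) z (insertAt-lookup w z 0) r≡0⇒z r-downClosed r≤k
            (λ i → m<n⇒m%n≡m (≤-<-trans (UniqueZeroOn-≤ uz i) j<k))
    where
    r≡0⇒z : ∀ i → lookup r i ≡ 0 → i ≡ z
    r≡0⇒z i r[i]≡0 with z ≟ i
    ... | yes z≡i = sym z≡i
    ... | no z≢i  = ⊥-elim (0∉positives j (subst (_∈ applyUpTo suc j) (trans (sym (lookup-insertAt-≢ w 0 z≢i)) r[i]≡0)
                                                (values (punchOut z≢i))))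
    r≤k : ∀ i → lookup r i ≤ k
    r≤k i = ≤-trans (UniqueZeroOn-≤ uz i) (<⇒≤ j<k)
    r-downClosed : ∀ i {e} → e ≤ lookup r i → ∃ λ i′ → lookup r i′ ≡ e
    r-downClosed i {zero}  _   = z , insertAt-lookup w z 0
    r-downClosed i {suc b} b<r = UniqueZeroOn-attains uz (∈-applyUpTo⁺ suc (≤-trans b<r (UniqueZeroOn-≤ uz i)))

  admissible-realisable : ∀ {m} (r : Vec ℕ (suc m)) → Admissible r → ∃ λ t → FullLinear t × residues t ≡ r
  admissible-realisable r (inj₁ onto)            = surjective-realisable r onto
  admissible-realisable r (inj₂ (j , j<pred[k] , uz)) = uniqueZero-realisable r (<-≤-trans j<pred[k] (<⇒≤ pred[k]<k)) uz

  admissibles : ∀ m → List (Vec ℕ (suc m))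
  admissibles m = surjections (suc m) (upTo k) ++ concatMap (λ j → uniqueZeros m (applyUpTo suc j)) (upTo (pred k))

  ∈-admissibles⁺ : ∀ {m} {r : Vec ℕ (suc m)} → Admissible r → r ∈ admissibles m
  ∈-admissibles⁺ {m} (inj₁ onto) = ∈-++⁺ˡ (∈-surjections⁺ (suc m) (upTo k) onto)
  ∈-admissibles⁺ {m} (inj₂ (j , j<pred[k] , uz)) =
    ∈-++⁺ʳ (surjections (suc m) (upTo k))
      (∈-concatMap⁺ (λ j → uniqueZeros m (applyUpTo suc j)) (lose (∈-upTo⁺ j<pred[k]) (∈-uniqueZeros⁺ m _ uz)))

  ∈-uniqueZeroPart⁻ : ∀ {m} {r : Vec ℕ (suc m)} → r ∈ concatMap (λ j → uniqueZeros m (applyUpTo suc j)) (upTo (pred k)) →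
                      ∃ λ j → j < pred k × UniqueZeroOn (applyUpTo suc j) r
  ∈-uniqueZeroPart⁻ {m} r∈ with find (∈-concatMap⁻ (λ j → uniqueZeros m (applyUpTo suc j)) {xs = upTo (pred k)} r∈)
  ... | j , j∈ , r∈uz = j , ∈-upTo⁻ j∈ , ∈-uniqueZeros⁻ m _ r∈uz

  ∈-admissibles⁻ : ∀ {m} {r : Vec ℕ (suc m)} → r ∈ admissibles m → Admissible r
  ∈-admissibles⁻ {m} r∈ with ∈-++⁻ (surjections (suc m) (upTo k)) r∈
  ... | inj₁ r∈surj = inj₁ (∈-surjections⁻ (suc m) (upTo k) r∈surj)
  ... | inj₂ r∈uz   = inj₂ (∈-uniqueZeroPart⁻ r∈uz)

  Unique-admissibles : ∀ m → Unique (admissibles m)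
  Unique-admissibles m = Unique.++⁺ (Unique-surjections (suc m) (Unique.upTo⁺ k))
    (Unique-concatMap (Unique.upTo⁺ (pred k)) (λ {j} _ → Unique-uniqueZeros m (Unique-positives j) (0∉positives j))
      (λ j≢j′ (r∈ , r∈′) → j≢j′ (UniqueZeroOn-≡ (∈-uniqueZeros⁻ m _ r∈) (∈-uniqueZeros⁻ m _ r∈′))))
    disjoint
    where
    disjoint : ∀ {r} → ¬ (r ∈ surjections (suc m) (upTo k) ×
                          r ∈ concatMap (λ j → uniqueZeros m (applyUpTo suc j)) (upTo (pred k)))
    disjoint (r∈surj , r∈uz) with ∈-uniqueZeroPart⁻ r∈uz
    ... | j , j<pred[k] , uz =
      let i , r[i]≡pred[k] = proj₂ (∈-surjections⁻ (suc m) (upTo k) r∈surj) (∈-upTo⁺ pred[k]<k)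
      in <-irrefl refl (≤-<-trans (subst (_≤ j) r[i]≡pred[k] (UniqueZeroOn-≤ uz i)) j<pred[k])

  length-admissibles : ∀ m → length (admissibles m) ≡ surjectionCount (suc m) k + suc m * sumTo (pred k) (surjectionCount m)
  length-admissibles m = trans (length-++ (surjections (suc m) (upTo k)))
    (cong₂ _+_ (trans (length-surjections (suc m) (Unique.upTo⁺ k)) (cong (surjectionCount (suc m)) (length-upTo k)))
               (length-concatMap (λ j → uniqueZeros m (applyUpTo suc j)) (surjectionCount m) (suc m) (upTo (pred k)) λ {j} _ →
                  trans (length-uniqueZeros m _) (cong (suc m *_)
                    (trans (length-surjections m (Unique-positives j)) (cong (surjectionCount m) (length-applyUpTo suc j))))))

-- Counting term operations by a complete invariant

module CountByInvariant {n : ℕ} {A : Set} (_∙_ : A → A → A) {X : Set} (inv : Term n → X)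
  (SameOp⇔inv≡ : ∀ {s t} → FullLinear s → FullLinear t → SameOp _∙_ s t ⇔ inv s ≡ inv t)
  (image : List X) (image! : Unique image)
  (image-realised : ∀ {x} → x ∈ image → ∃ λ t → FullLinear t × inv t ≡ x)
  (inv∈image : ∀ {t} → FullLinear t → inv t ∈ image) where

  private
    sameOp⇒inv≡ : ∀ {s t} → FullLinear s → FullLinear t → SameOp _∙_ s t → inv s ≡ inv t
    sameOp⇒inv≡ fs ft = Equivalence.to (SameOp⇔inv≡ fs ft)

    inv≡⇒sameOp : ∀ {s t} → FullLinear s → FullLinear t → inv s ≡ inv t → SameOp _∙_ s t
    inv≡⇒sameOp fs ft = Equivalence.from (SameOp⇔inv≡ fs ft)

  realiseAll : ∀ xs → (∀ {x} → x ∈ xs → ∃ λ t → FullLinear t × inv t ≡ x) →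
               ∃ λ ts → All FullLinear ts × map inv ts ≡ xs
  realiseAll []       _       = [] , [] , refl
  realiseAll (x ∷ xs) realise with realise (here refl) | realiseAll xs (realise ∘ there)
  ... | t , ft , refl | ts , fts , refl = t ∷ ts , ft ∷ fts , refl

  Unique⇒pairwise-¬SameOp : ∀ {ts} → All FullLinear ts → Unique (map inv ts) → Pairwise (λ s t → ¬ SameOp _∙_ s t) ts
  Unique⇒pairwise-¬SameOp {[]}     _          _              = tt
  Unique⇒pairwise-¬SameOp {t ∷ ts} (ft ∷ fts) (t∉ts ∷ ts!) =
    (λ s s∈ts t≈s → All.lookup t∉ts (∈-map⁺ inv s∈ts) (sameOp⇒inv≡ ft (All.lookup fts s∈ts) t≈s)) ,
    Unique⇒pairwise-¬SameOp fts ts!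

  pairwise-¬SameOp⇒Unique : ∀ {ts} → (∀ t → t ∈ ts → FullLinear t) → Pairwise (λ s t → ¬ SameOp _∙_ s t) ts →
                            Unique (map inv ts)
  pairwise-¬SameOp⇒Unique {[]}     _  _            = []
  pairwise-¬SameOp⇒Unique {t ∷ ts} fl (t≉ts , ts≉) =
    All.tabulate (λ {x} x∈ → λ inv[t]≡x → let s , s∈ts , x≡ = ∈-map⁻ inv x∈ in
      t≉ts s s∈ts (inv≡⇒sameOp (fl t (here refl)) (fl s (there s∈ts)) (trans inv[t]≡x x≡))) ∷
    pairwise-¬SameOp⇒Unique (λ s s∈ → fl s (there s∈)) ts≉

  sacIs : SacIs _∙_ n (length image)
  sacIs with realiseAll image image-realised
  ... | ts , fts , map-inv-ts≡image =
    ts , trans (sym (length-map inv ts)) (cong length map-inv-ts≡image) , (λ t t∈ → All.lookup fts t∈) ,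
    Unique⇒pairwise-¬SameOp fts (subst Unique (sym map-inv-ts≡image) image!) , cover
    where
    cover : (t : Term n) → FullLinear t → ∃ λ s → s ∈ ts × SameOp _∙_ t s
    cover t ft with ∈-map⁻ inv (subst (inv t ∈_) (sym map-inv-ts≡image) (inv∈image ft))
    ... | s , s∈ts , inv[t]≡inv[s] = s , s∈ts , inv≡⇒sameOp ft (All.lookup fts s∈ts) inv[t]≡inv[s]

  sacIs-unique : ∀ {N} → SacIs _∙_ n N → N ≡ length image
  sacIs-unique (L , refl , fl , pw , cover) = trans (sym (length-map inv L)) (≤-antisym
    (Unique-⊆⇒length≤ (pairwise-¬SameOp⇒Unique fl pw) λ x∈ →
       let t , t∈L , x≡ = ∈-map⁻ inv x∈ in subst (_∈ image) (sym x≡) (inv∈image (fl t t∈L)))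
    (Unique-⊆⇒length≤ image! λ x∈ → let t , ft , inv[t]≡x = image-realised x∈
                                        s , s∈L , t≈s = cover t ft
                                    in subst (_∈ map inv L) (trans (sym (sameOp⇒inv≡ ft (fl s s∈L) t≈s)) inv[t]≡x) (∈-map⁺ inv s∈L)))

module TermOperations (k : ℕ) .{{_ : NonZero k}} {A : Set} (_∙_ : A → A → A)
  (sameOp⇔≡[mod] : ∀ n (s t : Term n) → FullLinear s → FullLinear t →
                   SameOp _∙_ s t ⇔ ((i : Fin n) → rdepth s i ≡ rdepth t i [mod k ])) (m : ℕ) where
  open Residues k

  open CountByInvariant _∙_ (residues {suc m})
    (λ {s} {t} fs ft → ⇔.trans (sameOp⇔≡[mod] (suc m) s t fs ft) (≡[mod]⇔residues≡ s t))
    (admissibles m) (Unique-admissibles m)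
    (λ r∈ → admissible-realisable _ (∈-admissibles⁻ r∈))
    (λ {t} ft → ∈-admissibles⁺ (residues-admissible t ft))
    public using (sacIs; sacIs-unique)

-- Exponential generating functions

infix 7.5 _÷_
_÷_ : ℕ → (d : ℕ) → .{{NonZero d}} → ℚ
a ÷ d = ℤ.+ a ℚ./ d

fromℚᵘ-homo-+ : ∀ p q → fromℚᵘ (p ℚᵘ.+ q) ≡ fromℚᵘ p ℚ.+ fromℚᵘ q
fromℚᵘ-homo-+ p q = begin
  fromℚᵘ (p ℚᵘ.+ q)                               ≡⟨ ℚ.fromℚᵘ-cong (ℚᵘ.+-cong (ℚ.toℚᵘ-fromℚᵘ p) (ℚ.toℚᵘ-fromℚᵘ q)) ⟨
  fromℚᵘ (toℚᵘ (fromℚᵘ p) ℚᵘ.+ toℚᵘ (fromℚᵘ q))   ≡⟨ ℚ.fromℚᵘ-cong (ℚ.toℚᵘ-homo-+ (fromℚᵘ p) (fromℚᵘ q)) ⟨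
  fromℚᵘ (toℚᵘ (fromℚᵘ p ℚ.+ fromℚᵘ q))           ≡⟨ ℚ.fromℚᵘ-toℚᵘ _ ⟩
  fromℚᵘ p ℚ.+ fromℚᵘ q                           ∎

fromℚᵘ-homo-* : ∀ p q → fromℚᵘ (p ℚᵘ.* q) ≡ fromℚᵘ p ℚ.* fromℚᵘ q
fromℚᵘ-homo-* p q = begin
  fromℚᵘ (p ℚᵘ.* q)                               ≡⟨ ℚ.fromℚᵘ-cong (ℚᵘ.*-cong (ℚ.toℚᵘ-fromℚᵘ p) (ℚ.toℚᵘ-fromℚᵘ q)) ⟨
  fromℚᵘ (toℚᵘ (fromℚᵘ p) ℚᵘ.* toℚᵘ (fromℚᵘ q))   ≡⟨ ℚ.fromℚᵘ-cong (ℚ.toℚᵘ-homo-* (fromℚᵘ p) (fromℚᵘ q)) ⟨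
  fromℚᵘ (toℚᵘ (fromℚᵘ p ℚ.* fromℚᵘ q))           ≡⟨ ℚ.fromℚᵘ-toℚᵘ _ ⟩
  fromℚᵘ p ℚ.* fromℚᵘ q                           ∎

÷-cross : ∀ a d b e .{{_ : NonZero d}} .{{_ : NonZero e}} → a * e ≡ b * d → a ÷ d ≡ b ÷ e
÷-cross a (suc d) b (suc e) eq = ℚ.fromℚᵘ-cong {mkℚᵘ (ℤ.+ a) d} {mkℚᵘ (ℤ.+ b) e}
  (*≡* (trans (sym (pos-* a (suc e))) (trans (cong ℤ.+_ eq) (pos-* b (suc d)))))

÷-+ : ∀ a d b e .{{_ : NonZero d}} .{{_ : NonZero e}} → a ÷ d ℚ.+ b ÷ e ≡ ((a * e + b * d) ÷ (d * e)) {{m*n≢0 d e}}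
÷-+ a (suc d) b (suc e) = trans (sym (fromℚᵘ-homo-+ (mkℚᵘ (ℤ.+ a) d) (mkℚᵘ (ℤ.+ b) e)))
  (cong (λ n → n ℚ./ (suc d * suc e)) (trans (cong₂ ℤ._+_ (sym (pos-* a (suc e))) (sym (pos-* b (suc d))))
                                             (sym (pos-+ (a * suc e) (b * suc d)))))

÷-* : ∀ a d b e .{{_ : NonZero d}} .{{_ : NonZero e}} → a ÷ d ℚ.* b ÷ e ≡ ((a * b) ÷ (d * e)) {{m*n≢0 d e}}
÷-* a (suc d) b (suc e) = trans (sym (fromℚᵘ-homo-* (mkℚᵘ (ℤ.+ a) d) (mkℚᵘ (ℤ.+ b) e)))
  (cong (λ n → n ℚ./ (suc d * suc e)) (sym (pos-* a b)))

÷-+-same : ∀ a b d .{{_ : NonZero d}} → a ÷ d ℚ.+ b ÷ d ≡ (a + b) ÷ d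
÷-+-same a b d = trans (÷-+ a d b d) (÷-cross (a * d + b * d) (d * d) (a + b) d {{m*n≢0 d d}} (lemma a b d))
  where
  lemma : ∀ a b d → (a * d + b * d) * d ≡ (a + b) * (d * d)
  lemma = solve-∀

sumOver : List ℕ → (ℕ → ℕ) → ℕ
sumOver xs f = foldr (λ i acc → f i + acc) 0 xs

Σ< : ℕ → (ℕ → ℕ) → ℕ
Σ< zero    f = 0
Σ< (suc n) f = f 0 + Σ< n (f ∘ suc)

sumOver-applyUpTo : ∀ (f g : ℕ → ℕ) n → sumOver (applyUpTo g n) f ≡ Σ< n (f ∘ g)
sumOver-applyUpTo f g zero    = refl
sumOver-applyUpTo f g (suc n) = cong (f (g 0) +_) (sumOver-applyUpTo f (g ∘ suc) n)

Σ<-cong : ∀ n {f g : ℕ → ℕ} → (∀ i → i < n → f i ≡ g i) → Σ< n f ≡ Σ< n g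
Σ<-cong zero    _   = refl
Σ<-cong (suc n) f≡g = cong₂ _+_ (f≡g 0 (s≤s z≤n)) (Σ<-cong n (λ i i<n → f≡g (suc i) (s≤s i<n)))

Σ<-+ : ∀ n (f g : ℕ → ℕ) → Σ< n (λ i → f i + g i) ≡ Σ< n f + Σ< n g
Σ<-+ zero    f g = refl
Σ<-+ (suc n) f g = trans (cong (f 0 + g 0 +_) (Σ<-+ n (f ∘ suc) (g ∘ suc))) (lemma (f 0) (g 0) _ _)
  where
  lemma : ∀ a b c d → a + b + (c + d) ≡ a + c + (b + d)
  lemma = solve-∀

Σ<-* : ∀ n c (f : ℕ → ℕ) → Σ< n (λ i → c * f i) ≡ c * Σ< n f
Σ<-* zero    c f = sym (*-zeroʳ c)
Σ<-* (suc n) c f = trans (cong (c * f 0 +_) (Σ<-* n c (f ∘ suc))) (sym (*-distribˡ-+ c (f 0) _))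

Σ<-snoc : ∀ n (f : ℕ → ℕ) → Σ< (suc n) f ≡ Σ< n f + f n
Σ<-snoc zero    f = +-identityʳ (f 0)
Σ<-snoc (suc n) f = trans (cong (f 0 +_) (Σ<-snoc n (f ∘ suc))) (sym (+-assoc (f 0) _ _))

sumℚ-cong : ∀ {f g : ℕ → ℚ} xs → (∀ {i} → i ∈ xs → f i ≡ g i) → sumℚ (map f xs) ≡ sumℚ (map g xs)
sumℚ-cong []       _   = refl
sumℚ-cong (x ∷ xs) f≡g = cong₂ ℚ._+_ (f≡g (here refl)) (sumℚ-cong xs (f≡g ∘ there))

sumℚ-÷ : ∀ (f : ℕ → ℕ) d .{{_ : NonZero d}} xs → sumℚ (map (λ i → f i ÷ d) xs) ≡ sumOver xs f ÷ d
sumℚ-÷ f d []       = sym (ℚ.0/n≡0 d)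
sumℚ-÷ f d (x ∷ xs) = trans (cong (f x ÷ d ℚ.+_) (sumℚ-÷ f d xs)) (÷-+-same (f x) _ d)

sumℚ-zero : ∀ {f : ℕ → ℚ} xs → (∀ {i} → i ∈ xs → f i ≡ 0ℚ) → sumℚ (map f xs) ≡ 0ℚ
sumℚ-zero []       _    = refl
sumℚ-zero (x ∷ xs) f≡0 = trans (cong₂ ℚ._+_ (f≡0 (here refl)) (sumℚ-zero xs (f≡0 ∘ there))) (ℚ.+-identityˡ 0ℚ)

sumPS-apply : ∀ m (F : ℕ → PS) n → sumPS m F n ≡ sumℚ (map (λ i → F i n) (upTo m))
sumPS-apply m F n = go (upTo m)
  where
  go : ∀ xs → foldr (λ i acc → F i ⊕ acc) zeroPS xs n ≡ sumℚ (map (λ i → F i n) xs)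
  go []       = refl
  go (x ∷ xs) = cong (F x n ℚ.+_) (go xs)

⊛-cong : ∀ {f f′ g g′ : PS} → (∀ n → f n ≡ f′ n) → (∀ n → g n ≡ g′ n) → ∀ n → (f ⊛ g) n ≡ (f′ ⊛ g′) n
⊛-cong f≡ g≡ n = sumℚ-cong (upTo (suc n)) (λ {i} _ → cong₂ ℚ._*_ (f≡ i) (g≡ (n ∸ i)))

nCk*k!*[n∸k]!≡n! : ∀ {n k} → k ≤ n → (n C k) * (k ! * (n ∸ k) !) ≡ n !
nCk*k!*[n∸k]!≡n! {n} {k} k≤n =
  trans (cong (_* (k ! * (n ∸ k) !)) (nCk≡n!/k![n-k]! k≤n)) (m/n*n≡m {{k !* (n ∸ k) !≢0}} (k![n∸k]!∣n! k≤n))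

nC0≡1 : ∀ n → n C 0 ≡ 1
nC0≡1 n = *-cancelʳ-≡ (n C 0) 1 (n !) {{n !≢0}} (begin
  (n C 0) * n !        ≡⟨ cong ((n C 0) *_) (*-identityˡ (n !)) ⟨
  (n C 0) * (1 * n !)  ≡⟨ nCk*k!*[n∸k]!≡n! {n} {0} z≤n ⟩
  n !                  ≡⟨ *-identityˡ (n !) ⟨
  1 * n !              ∎)

infix 7.5 _/!_
_/!_ : ℕ → ℕ → ℚ
a /! n = (a ÷ n !) {{n !≢0}}

egf : (ℕ → ℕ) → PS
egf a n = a n /! n

egf-⊛ : ∀ a b n → (egf a ⊛ egf b) n ≡ egf (λ n → Σ< (suc n) (λ i → (n C i) * (a i * b (n ∸ i)))) n
egf-⊛ a b n = begin
  sumℚ (map (λ i → a i /! i ℚ.* b (n ∸ i) /! (n ∸ i)) (upTo (suc n)))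
    ≡⟨ sumℚ-cong (upTo (suc n)) (λ i∈ → term (≤-pred (∈-upTo⁻ i∈))) ⟩
  sumℚ (map (λ i → ((n C i) * (a i * b (n ∸ i))) /! n) (upTo (suc n)))
    ≡⟨ sumℚ-÷ (λ i → (n C i) * (a i * b (n ∸ i))) (n !) {{n !≢0}} (upTo (suc n)) ⟩
  sumOver (upTo (suc n)) (λ i → (n C i) * (a i * b (n ∸ i))) /! n
    ≡⟨ cong (_/! n) (sumOver-applyUpTo (λ i → (n C i) * (a i * b (n ∸ i))) id (suc n)) ⟩
  Σ< (suc n) (λ i → (n C i) * (a i * b (n ∸ i))) /! n ∎
  where
  term : ∀ {i} → i ≤ n → a i /! i ℚ.* b (n ∸ i) /! (n ∸ i) ≡ ((n C i) * (a i * b (n ∸ i))) /! n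
  term {i} i≤n = trans (÷-* (a i) (i !) (b (n ∸ i)) ((n ∸ i) !) {{i !≢0}} {{(n ∸ i) !≢0}})
    (÷-cross (a i * b (n ∸ i)) (i ! * (n ∸ i) !) ((n C i) * (a i * b (n ∸ i))) (n !) {{i !* (n ∸ i) !≢0}} {{n !≢0}} (begin
      a i * b (n ∸ i) * n !                                ≡⟨ cong (a i * b (n ∸ i) *_) (nCk*k!*[n∸k]!≡n! i≤n) ⟨
      a i * b (n ∸ i) * ((n C i) * (i ! * (n ∸ i) !))      ≡⟨ lemma (a i * b (n ∸ i)) (n C i) (i ! * (n ∸ i) !) ⟩
      (n C i) * (a i * b (n ∸ i)) * (i ! * (n ∸ i) !)      ∎))
    where
    lemma : ∀ x c f → x * (c * f) ≡ c * x * f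
    lemma = solve-∀

shifted-convolution : ∀ n k → Σ< n (λ i → (n C suc i) * surjectionCount (n ∸ suc i) k) ≡ surjectionCount n (suc k)
shifted-convolution zero    k = sym (*-zeroʳ (suc k !))
shifted-convolution (suc n) k = begin
  Σ< (suc n) (λ i → (suc n C suc i) * sc (n ∸ i) k)
    ≡⟨ Σ<-cong (suc n) (λ i _ → cong (_* sc (n ∸ i) k) (sym (nCk+nC[k+1]≡[n+1]C[k+1] n i))) ⟩
  Σ< (suc n) (λ i → (n C i + n C suc i) * sc (n ∸ i) k)
    ≡⟨ Σ<-cong (suc n) (λ i _ → *-distribʳ-+ (sc (n ∸ i) k) (n C i) (n C suc i)) ⟩
  Σ< (suc n) (λ i → (n C i) * sc (n ∸ i) k + (n C suc i) * sc (n ∸ i) k)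
    ≡⟨ Σ<-+ (suc n) (λ i → (n C i) * sc (n ∸ i) k) (λ i → (n C suc i) * sc (n ∸ i) k) ⟩
  Σ< (suc n) (λ i → (n C i) * sc (n ∸ i) k) + Σ< (suc n) (λ i → (n C suc i) * sc (n ∸ i) k)
    ≡⟨ cong₂ _+_ unshifted shifted ⟩
  (sc n k + sc n (suc k)) + k * (sc n (suc k) + sc n (suc (pred k)))
    ≡⟨ combine k ⟩
  sc (suc n) (suc k) ∎
  where
  sc = surjectionCount
  unshifted : Σ< (suc n) (λ i → (n C i) * sc (n ∸ i) k) ≡ sc n k + sc n (suc k)
  unshifted = cong₂ _+_ (trans (cong (_* sc n k) (nC0≡1 n)) (*-identityˡ (sc n k))) (shifted-convolution n k)
  shifted : Σ< (suc n) (λ i → (n C suc i) * sc (n ∸ i) k) ≡ k * (sc n (suc k) + sc n (suc (pred k)))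
  shifted = begin
    Σ< (suc n) (λ i → (n C suc i) * sc (n ∸ i) k)
      ≡⟨ Σ<-snoc n _ ⟩
    Σ< n (λ i → (n C suc i) * sc (n ∸ i) k) + (n C suc n) * sc (n ∸ n) k
      ≡⟨ cong (λ c → Σ< n (λ i → (n C suc i) * sc (n ∸ i) k) + c * sc (n ∸ n) k) (k>n⇒nCk≡0 (n<1+n n)) ⟩
    Σ< n (λ i → (n C suc i) * sc (n ∸ i) k) + 0
      ≡⟨ +-identityʳ _ ⟩
    Σ< n (λ i → (n C suc i) * sc (n ∸ i) k)
      ≡⟨ Σ<-cong n (λ i i<n → cong (λ m → (n C suc i) * sc m k) (+-∸-assoc 1 i<n)) ⟩
    Σ< n (λ i → (n C suc i) * sc (suc (n ∸ suc i)) k)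
      ≡⟨ Σ<-cong n (λ i _ → trans (cong ((n C suc i) *_) (sym (surjectionCount-suc (n ∸ suc i) k)))
                                  (distrib (n C suc i) k _ _)) ⟩
    Σ< n (λ i → k * ((n C suc i) * sc (n ∸ suc i) k + (n C suc i) * sc (n ∸ suc i) (pred k)))
      ≡⟨ Σ<-* n k _ ⟩
    k * Σ< n (λ i → (n C suc i) * sc (n ∸ suc i) k + (n C suc i) * sc (n ∸ suc i) (pred k))
      ≡⟨ cong (k *_) (Σ<-+ n (λ i → (n C suc i) * sc (n ∸ suc i) k) (λ i → (n C suc i) * sc (n ∸ suc i) (pred k))) ⟩
    k * (Σ< n (λ i → (n C suc i) * sc (n ∸ suc i) k) + Σ< n (λ i → (n C suc i) * sc (n ∸ suc i) (pred k)))
      ≡⟨ cong (k *_) (cong₂ _+_ (shifted-convolution n k) (shifted-convolution n (pred k))) ⟩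
    k * (sc n (suc k) + sc n (suc (pred k))) ∎
    where
    distrib : ∀ c k x y → c * (k * (x + y)) ≡ k * (c * x + c * y)
    distrib = solve-∀
  combine : ∀ k → (sc n k + sc n (suc k)) + k * (sc n (suc k) + sc n (suc (pred k))) ≡ sc (suc n) (suc k)
  combine zero    = trans (lemma (sc n 0) (sc n 1)) (surjectionCount-suc n 1)
    where
    lemma : ∀ x y → x + y + 0 ≡ 1 * (y + x)
    lemma = solve-∀
  combine (suc k) = trans (lemma k (sc n (suc k)) (sc n (suc (suc k)))) (surjectionCount-suc n (suc (suc k)))
    where
    lemma : ∀ k x y → x + y + suc k * (y + x) ≡ suc (suc k) * (y + x)
    lemma = solve-∀

positive : ℕ → ℕ
positive zero    = 0
positive (suc _) = 1

expm1≡egf : ∀ n → expm1 n ≡ egf positive n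
expm1≡egf zero    = sym (ℚ.0/n≡0 1)
expm1≡egf (suc n) = refl

expm1^≡egf : ∀ k n → (expm1 ^PS k) n ≡ egf (λ n → surjectionCount n k) n
expm1^≡egf zero    zero    = refl
expm1^≡egf zero    (suc n) = sym (ℚ.0/n≡0 (suc n !) {{suc n !≢0}})
expm1^≡egf (suc k) n = begin
  (expm1 ⊛ (expm1 ^PS k)) n
    ≡⟨ ⊛-cong expm1≡egf (expm1^≡egf k) n ⟩
  (egf positive ⊛ egf (λ n → surjectionCount n k)) n
    ≡⟨ egf-⊛ positive (λ n → surjectionCount n k) n ⟩
  Σ< (suc n) (λ i → (n C i) * (positive i * surjectionCount (n ∸ i) k)) /! n
    ≡⟨ cong (_/! n) (cong₂ _+_ (*-zeroʳ (n C 0))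
                               (Σ<-cong n (λ i _ → cong ((n C suc i) *_) (*-identityˡ (surjectionCount (n ∸ suc i) k))))) ⟩
  Σ< n (λ i → (n C suc i) * surjectionCount (n ∸ suc i) k) /! n
    ≡⟨ cong (_/! n) (shifted-convolution n k) ⟩
  surjectionCount n (suc k) /! n ∎

tPS⊛-shift : ∀ (f : PS) m → (tPS ⊛ f) (suc m) ≡ f m
tPS⊛-shift f m = begin
  0ℚ ℚ.* f (suc m) ℚ.+ (1ℚ ℚ.* f m ℚ.+ sumℚ (map (λ i → tPS i ℚ.* f (suc m ∸ i)) (applyUpTo (2 +_) m)))
    ≡⟨ cong₂ ℚ._+_ (ℚ.*-zeroˡ (f (suc m)))
                   (cong₂ ℚ._+_ (ℚ.*-identityˡ (f m)) (sumℚ-zero (applyUpTo (2 +_) m) beyond1)) ⟩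
  0ℚ ℚ.+ (f m ℚ.+ 0ℚ)
    ≡⟨ trans (ℚ.+-identityˡ _) (ℚ.+-identityʳ (f m)) ⟩
  f m ∎
  where
  beyond1 : ∀ {i} → i ∈ applyUpTo (2 +_) m → tPS i ℚ.* f (suc m ∸ i) ≡ 0ℚ
  beyond1 i∈ with ∈-applyUpTo⁻ (2 +_) i∈
  ... | j , _ , refl = ℚ.*-zeroˡ (f (suc m ∸ suc (suc j)))

egf-coefficient : ∀ k m → (surjectionCount (suc m) k + suc m * sumTo (pred k) (surjectionCount m)) /! suc m
              ≡ ((expm1 ^PS k) ⊕ sumPS (pred k) (λ i → tPS ⊛ (expm1 ^PS i))) (suc m)
egf-coefficient k m = begin
  (surjectionCount (suc m) k + suc m * X) /! suc m
    ≡⟨ ÷-+-same (surjectionCount (suc m) k) (suc m * X) (suc m !) {{suc m !≢0}} ⟨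
  surjectionCount (suc m) k /! suc m ℚ.+ (suc m * X) /! suc m
    ≡⟨ cong₂ ℚ._+_ (sym (expm1^≡egf k (suc m)))
                   (÷-cross (suc m * X) (suc m !) X (m !) {{suc m !≢0}} {{m !≢0}} (lemma m X (m !))) ⟩
  (expm1 ^PS k) (suc m) ℚ.+ X /! m
    ≡⟨ cong ((expm1 ^PS k) (suc m) ℚ.+_) (sumℚ-÷ (surjectionCount m) (m !) {{m !≢0}} (upTo (pred k))) ⟨
  (expm1 ^PS k) (suc m) ℚ.+ sumℚ (map (λ i → surjectionCount m i /! m) (upTo (pred k)))
    ≡⟨ cong ((expm1 ^PS k) (suc m) ℚ.+_)
            (sumℚ-cong (upTo (pred k)) (λ {i} _ → trans (sym (expm1^≡egf i m)) (sym (tPS⊛-shift (expm1 ^PS i) m)))) ⟩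
  (expm1 ^PS k) (suc m) ℚ.+ sumℚ (map (λ i → (tPS ⊛ (expm1 ^PS i)) (suc m)) (upTo (pred k)))
    ≡⟨ cong ((expm1 ^PS k) (suc m) ℚ.+_) (sumPS-apply (pred k) (λ i → tPS ⊛ (expm1 ^PS i)) (suc m)) ⟨
  ((expm1 ^PS k) ⊕ sumPS (pred k) (λ i → tPS ⊛ (expm1 ^PS i))) (suc m) ∎
  where
  X = sumTo (pred k) (surjectionCount m)
  lemma : ∀ m x f → suc m * x * f ≡ x * (f + m * f)
  lemma = solve-∀

-- Imported only here: the prefix +_ would make sections such as (x +_) above ambiguous.
open import Data.Integer using (+_)

theorem7p9 : (k : ℕ) → 2 ≤ k →
    {A : Set} (_∙_ : A → A → A) →
    ((n : ℕ) (s t : Term n) → FullLinear s → FullLinear t →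
      SameOp _∙_ s t ⇔ ((i : Fin n) → rdepth s i ≡ rdepth t i [mod k ])) →
    ((n : ℕ) → 1 ≤ n →
      SacIs _∙_ n (k ! * S n k + n * sumTo (k ∸ 1) (λ i → i ! * S (n ∸ 1) i)))
    × ((a : ℕ → ℕ) → ((n : ℕ) → 1 ≤ n → SacIs _∙_ n (a n)) →
      (n : ℕ) → 1 ≤ n →
        ℚ._/_ (+ a n) (n !) {{n !≢0}}
          ≡ ((expm1 ^PS k) ⊕ sumPS (k ∸ 1) (λ i → tPS ⊛ (expm1 ^PS i))) n)
theorem7p9 zero () _
theorem7p9 k@(suc _) _ _∙_ sameOp⇔≡[mod] =
  (λ { zero () ; (suc m) _ → subst (SacIs _∙_ (suc m)) (length-admissibles m) (sacIs m) }) ,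
  (λ { a _ zero () ; a sacIs-a (suc m) _ →
       trans (cong (_/! suc m) (trans (sacIs-unique m (sacIs-a (suc m) (s≤s z≤n))) (length-admissibles m)))
             (egf-coefficient k m) })
  where
  open Residues k using (length-admissibles)
  open TermOperations k _∙_ sameOp⇔≡[mod]
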